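{- For any integers $r,t,n$ with $3\le r<t\le \frac{n+r-2}{2}$ there exists a connected graph $G$ of order $n$ with $pd_s(G)=r$ and $dim_s(G)=t$.
   Context: Graphs are finite, simple, connected; $d_G$ is shortest-path distance, $d_G(x,W)=\min\{d_G(x,w):w\in W\}$. A vertex $v$ strongly resolves different vertices $x,y$ if $d_G(x,v)=d_G(x,y)+d_G(y,v)$ or $d_G(y,v)=d_G(y,x)+d_G(x,v)$; the strong metric dimension $dim_s(G)$ is the minimum size of a vertex set $S$ such that every two vertices are strongly resolved by some vertex of $S$. A set $W$ strongly resolves different vertices $x,y\notin W$ if $d_G(x,W)=d_G(x,y)+d_G(y,W)$ or $d_G(y,W)=d_G(y,x)+d_G(x,W)$. A vertex partition $\Pi$ is a strong resolving partition if every two different vertices in the same set of $\Pi$ are strongly resolved by some set of $\Pi$; $pd_s(G)$ is the minimum cardinality of such a partition. -}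

module Defs where

open import Data.Nat using (ℕ; zero; suc; _+_; _≤_)
open import Data.Fin using (Fin)
open import Data.Fin.Subset using (Subset; _∈_; _∉_; ∣_∣)
open import Data.Bool using (Bool; true; false)
open import Data.Product using (Σ; ∃; ∃-syntax; _×_; _,_)
open import Data.Sum using (_⊎_)
open import Relation.Binary.PropositionalEquality using (_≡_; _≢_)
open import Relation.Nullary using (¬_)

record Graph (n : ℕ) : Set where
  field
    adj   : Fin n → Fin n → Bool
    sym   : ∀ x y → adj x y ≡ adj y x
    irrefl : ∀ x → adj x x ≡ false
open Graph public

data Walk {n : ℕ} (G : Graph n) : Fin n → Fin n → ℕ → Set where
  nil  : ∀ {x} → Walk G x x 0
  cons : ∀ {x y z k} → adj G x y ≡ true → Walk G y z k → Walk G x z (suc k)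

Connected : ∀ {n} → Graph n → Set
Connected G = ∀ x y → ∃[ k ] Walk G x y k

Dist : ∀ {n} → Graph n → Fin n → Fin n → ℕ → Set
Dist G x y k = Walk G x y k × (∀ m → Walk G x y m → k ≤ m)

DistSet : ∀ {n} → Graph n → Fin n → Subset n → ℕ → Set
DistSet G x W k =
  (∃[ w ] (w ∈ W × Dist G x w k)) × (∀ w m → w ∈ W → Dist G x w m → k ≤ m)

StronglyResolvesV : ∀ {n} → Graph n → Fin n → Fin n → Fin n → Set
StronglyResolvesV G v x y =
  ∃[ a ] ∃[ b ] ∃[ c ] (Dist G x v a × Dist G x y b × Dist G y v c ×
    (a ≡ b + c ⊎ c ≡ b + a))

StrongResolvingSet : ∀ {n} → Graph n → Subset n → Set
StrongResolvingSet G S =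
  ∀ x y → x ≢ y → ∃[ v ] (v ∈ S × StronglyResolvesV G v x y)

IsMin : (ℕ → Set) → ℕ → Set
IsMin P k = P k × (∀ m → P m → k ≤ m)

dimₛ≡ : ∀ {n} → Graph n → ℕ → Set
dimₛ≡ {n} G t = IsMin (λ k → ∃[ S ] (∣ S ∣ ≡ k × StrongResolvingSet G S)) t

StronglyResolvesSet : ∀ {n} → Graph n → Subset n → Fin n → Fin n → Set
StronglyResolvesSet G W x y =
  x ∉ W × y ∉ W ×
  ∃[ a ] ∃[ b ] ∃[ c ] (DistSet G x W a × Dist G x y b × DistSet G y W c ×
    (a ≡ b + c ⊎ c ≡ b + a))

-- Partition into k (nonempty) classes given by a surjective labelling f;
-- class i = { v | f v ≡ i }.
Class : ∀ {n k} → (Fin n → Fin k) → Fin k → Subset n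
Class {zero}  f i = Data.Vec.[]
  where import Data.Vec
Class {suc n} f i = Data.Vec._∷_ (isEq (f Fin.zero) i) (Class (λ v → f (Fin.suc v)) i)
  where
  import Data.Vec
  import Data.Fin as Fin
  open import Data.Fin.Properties using (_≟_)
  open import Relation.Nullary using (does)
  isEq : ∀ {k} → Fin k → Fin k → Bool
  isEq a b = does (a ≟ b)

Surjective : ∀ {n k} → (Fin n → Fin k) → Set
Surjective {n} {k} f = ∀ (i : Fin k) → ∃[ v ] (f v ≡ i)

StrongResolvingPartition : ∀ {n k} → Graph n → (Fin n → Fin k) → Set
StrongResolvingPartition G f =
  Surjective f ×
  (∀ x y → x ≢ y → f x ≡ f y → ∃[ i ] StronglyResolvesSet G (Class f i) x y)

pdₛ≡ : ∀ {n} → Graph n → ℕ → Set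
pdₛ≡ {n} G r =
  IsMin (λ k → Σ (Fin n → Fin k) (StrongResolvingPartition G)) r

module Submission where

-- Call x, y mutually maximal when no third vertex lies beyond one of them on a
-- geodesic through the other.  Such a pair is strongly resolved only by x or y and
-- by no set avoiding both, so strong resolving sets meet it and strong resolving
-- partitions separate it: pairwise mutually maximal families (twins, diametral
-- pairs) bound dimₛ and pdₛ from below.  The graph is layered (adjacent iff levels
-- differ by ≤ 1, so distances are level differences): a root on level 0, m twin
-- pairs on levels 1..m, a spine through all inner levels, s top vertices on level
-- L.  Root and tops give pdₛ ≥ s + 1, adding the twin pairs dimₛ ≥ m + s; the
-- partition resolved by {root} and the set twins ∪ tops attain these bounds.

open import Defs hiding (sym)
open import Data.Bool using (Bool; true; false; T)
open import Data.Empty using (⊥-elim)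
open import Data.Fin using (Fin; zero; suc; toℕ; fromℕ<; _↑ˡ_; _↑ʳ_; splitAt)
open import Data.Fin.Properties
  using (_≟_; toℕ-injective; toℕ<n; toℕ-↑ˡ; toℕ-fromℕ<; splitAt-↑ˡ; splitAt-↑ʳ;
         splitAt⁻¹-↑ˡ; splitAt⁻¹-↑ʳ; injective⇒≤)
  renaming (suc-injective to fin-suc-injective)
open import Data.Fin.Subset using (Subset; _∈_; _∉_; ∣_∣; inside; outside; ⊤; ⊥)
open import Data.Fin.Subset.Properties using (_∈?_; ∈⊤; ∣⊤∣≡n; ∣⊥∣≡0)
open import Data.Nat
  using (ℕ; zero; suc; _+_; _*_; _≤_; _<_; _∸_; _⊔_; ∣_-_∣; z≤n; s≤s; s≤s⁻¹; _≤ᵇ_)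
open import Data.Nat.Properties hiding (_≟_)
open import Data.Nat.Tactic.RingSolver using (solve-∀)
open import Data.Product using (Σ-syntax; ∃-syntax; _×_; _,_; proj₁; proj₂)
  renaming (swap to ×-swap)
open import Data.Sum using (_⊎_; inj₁; inj₂; [_,_]; swap)
open import Data.Vec using ([]; _∷_; _++_; here; there)
open import Function using (_∘_)
open import Function.Definitions using (Injective)
open import Relation.Binary.Definitions using (tri<; tri≈; tri>)
open import Relation.Binary.PropositionalEquality hiding ([_])
open import Relation.Nullary using (¬_; yes; no)

-- The gap between levels u and w: their difference, but at least 1.  In the
-- layered graphs of the construction this is the distance between distinct
-- vertices on these levels.
gap : ℕ → ℕ → ℕ
gap u w = ∣ u - w ∣ ⊔ 1

gap-comm : ∀ u w → gap u w ≡ gap w u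
gap-comm u w = cong (_⊔ 1) (∣-∣-comm u w)

gap-self : ∀ {u w} → u ≡ w → gap u w ≡ 1
gap-self {u} refl = cong (_⊔ 1) (∣n-n∣≡0 u)

gap-triangle : ∀ u w z → gap u z ≤ gap u w + gap w z
gap-triangle u w z =
  ⊔-lub (≤-trans (∣-∣-triangle u w z)
                 (+-mono-≤ (m≤m⊔n ∣ u - w ∣ 1) (m≤m⊔n ∣ w - z ∣ 1)))
        (≤-trans (m≤n⊔m ∣ u - w ∣ 1) (m≤m+n (gap u w) (gap w z)))

gap-above : ∀ u d → gap u (u + suc d) ≡ suc d
gap-above u d = trans (cong (_⊔ 1) (∣m-m+n∣≡n u (suc d))) (m≥n⇒m⊔n≡m (s≤s z≤n))

gap-< : ∀ {u w} → u < w → gap u w ≡ w ∸ u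
gap-< {u} {w} u<w =
  trans (cong (_⊔ 1) (m≤n⇒∣m-n∣≡n∸m (<⇒≤ u<w))) (m≥n⇒m⊔n≡m (m<n⇒0<n∸m u<w))

gap-additive : ∀ {u w z} → u < w → w < z → gap u z ≡ gap u w + gap w z
gap-additive {u} {w} {z} u<w w<z = begin
  gap u z               ≡⟨ gap-< (<-trans u<w w<z) ⟩
  z ∸ u                 ≡⟨ cong (_∸ u) (m∸n+n≡m (<⇒≤ w<z)) ⟨
  (z ∸ w) + w ∸ u       ≡⟨ +-∸-assoc (z ∸ w) (<⇒≤ u<w) ⟩
  (z ∸ w) + (w ∸ u)     ≡⟨ +-comm (z ∸ w) (w ∸ u) ⟩
  (w ∸ u) + (z ∸ w)     ≡⟨ cong₂ _+_ (gap-< u<w) (gap-< w<z) ⟨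
  gap u w + gap w z     ∎
  where open ≡-Reasoning

gap-bounded : ∀ {u w L} → 1 ≤ L → u ≤ L → w ≤ L → gap u w ≤ L
gap-bounded {u} {w} 1≤L u≤L w≤L =
  ⊔-lub (≤-trans (∣m-n∣≤m⊔n u w) (⊔-lub u≤L w≤L)) 1≤L

HasDistances : ∀ {n} → Graph n → Set
HasDistances {n} G = ∀ (x y : Fin n) → ∃[ k ] Dist G x y k

-- x and y are mutually maximal (a geodesic form of "mutually maximally
-- distant"): no third vertex v has y on a geodesic from x to v, or x on a
-- geodesic from y to v.
MutuallyMaximal : ∀ {n} → Graph n → Fin n → Fin n → Set
MutuallyMaximal G x y = ∀ v {a b c} → v ≢ x → v ≢ y →
  Dist G x v a → Dist G x y b → Dist G y v c → a < b + c × c < b + a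

module _ {n : ℕ} {G : Graph n} where

  dist-unique : ∀ {x y a b} → Dist G x y a → Dist G x y b → a ≡ b
  dist-unique (walk-a , min-a) (walk-b , min-b) = ≤-antisym (min-a _ walk-b) (min-b _ walk-a)

  dist-refl : ∀ {x} → Dist G x x 0
  dist-refl = nil , λ _ _ → z≤n

  snoc : ∀ {x y z k} → Walk G x y k → adj G y z ≡ true → Walk G x z (suc k)
  snoc nil        yz = cons yz nil
  snoc (cons e w) yz = cons e (snoc w yz)

  reverse : ∀ {x y k} → Walk G x y k → Walk G y x k
  reverse nil                          = nil
  reverse (cons {x = x} {y = y} xy w) = snoc (reverse w) (trans (Graph.sym G y x) xy)

  dist-sym : ∀ {x y k} → Dist G x y k → Dist G y x k
  dist-sym (walk , minimal) = reverse walk , λ m w → minimal m (reverse w)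

  dist-pos : ∀ {x y k} → x ≢ y → Dist G x y k → 1 ≤ k
  dist-pos x≢y (nil , _)      = ⊥-elim (x≢y refl)
  dist-pos _   (cons _ _ , _) = s≤s z≤n

  resolves-sym : ∀ {v x y} → StronglyResolvesV G v x y → StronglyResolvesV G v y x
  resolves-sym (a , b , c , xv , xy , yv , geodesic) =
    c , b , a , yv , dist-sym xy , xv , swap geodesic

  endpoint-resolves : ∀ {x y b} → Dist G x y b → StronglyResolvesV G y x y
  endpoint-resolves {b = b} xy = b , b , 0 , xy , xy , dist-refl , inj₁ (sym (+-identityʳ b))

  mm-sym : ∀ {x y} → MutuallyMaximal G x y → MutuallyMaximal G y x
  mm-sym mm v v≢y v≢x yv yx xv = ×-swap (mm v v≢x v≢y xv (dist-sym yx) yv)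

  twins-mm : ∀ {x y} → Dist G x y 1 →
    (∀ v {a c} → v ≢ x → v ≢ y → Dist G x v a → Dist G y v c → a ≡ c) →
    MutuallyMaximal G x y
  twins-mm xy₁ equidistant v v≢x v≢y xv xy yv
    rewrite dist-unique xy xy₁ | equidistant v v≢x v≢y xv yv = n<1+n _ , n<1+n _

  diametral-mm : ∀ {x y D} → Dist G x y D → (∀ {u v k} → Dist G u v k → k ≤ D) →
    MutuallyMaximal G x y
  diametral-mm {D = D} xy₀ diameter v v≢x v≢y xv xy yv rewrite dist-unique xy xy₀ =
    beyond xv (dist-pos (v≢y ∘ sym) yv) , beyond yv (dist-pos (v≢x ∘ sym) xv)
    where
    beyond : ∀ {u w k l} → Dist G u w k → 1 ≤ l → k < D + l
    beyond uw 1≤l = ≤-<-trans (diameter uw) (m<m+n D 1≤l)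

  mm-vertex : ∀ {x y v} → MutuallyMaximal G x y → StronglyResolvesV G v x y →
    v ≡ x ⊎ v ≡ y
  mm-vertex {x} {y} {v} mm (a , b , c , xv , xy , yv , geodesic) with v ≟ x | v ≟ y
  ... | yes v≡x | _       = inj₁ v≡x
  ... | no _    | yes v≡y = inj₂ v≡y
  ... | no v≢x  | no v≢y with mm v v≢x v≢y xv xy yv | geodesic
  ...   | a<b+c , _ | inj₁ a≡b+c = ⊥-elim (<-irrefl a≡b+c a<b+c)
  ...   | _ , c<b+a | inj₂ c≡b+a = ⊥-elim (<-irrefl c≡b+a c<b+a)

  avoid : ∀ {z w : Fin n} {W : Subset n} → z ∈ W → w ∉ W → z ≢ w
  avoid z∈W w∉W refl = w∉W z∈W

  mm-set : ∀ {x y W} → HasDistances G → MutuallyMaximal G x y →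
    ¬ StronglyResolvesSet G W x y
  mm-set {x} {y} {W} dists mm (x∉W , y∉W , a , b , c ,
                               ((z , z∈W , xz) , min-x) , xy , ((z′ , z′∈W , yz′) , min-y) , geodesic)
    with geodesic
  ... | inj₁ a≡b+c = <-irrefl a≡b+c (≤-<-trans (min-x z′ _ z′∈W xz′) d[x,z′]<b+c)
    where
    xz′ : Dist G x z′ (proj₁ (dists x z′))
    xz′ = proj₂ (dists x z′)
    d[x,z′]<b+c : proj₁ (dists x z′) < b + c
    d[x,z′]<b+c = proj₁ (mm z′ (avoid z′∈W x∉W) (avoid z′∈W y∉W) xz′ xy yz′)
  ... | inj₂ c≡b+a = <-irrefl c≡b+a (≤-<-trans (min-y z _ z∈W yz) d[y,z]<b+a)
    where
    yz : Dist G y z (proj₁ (dists y z))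
    yz = proj₂ (dists y z)
    d[y,z]<b+a : proj₁ (dists y z) < b + a
    d[y,z]<b+a = proj₂ (mm z (avoid z∈W x∉W) (avoid z∈W y∉W) xz xy yz)

  singleton-resolves : ∀ {W z x y} → z ∈ W → (∀ {w} → w ∈ W → w ≡ z) → x ∉ W → y ∉ W →
    StronglyResolvesV G z x y → StronglyResolvesSet G W x y
  singleton-resolves {W} {z} z∈W only-z x∉W y∉W (a , b , c , xz , xy , yz , geodesic) =
    x∉W , y∉W , a , b , c ,
    ((z , z∈W , xz) , nearest xz) , xy , ((z , z∈W , yz) , nearest yz) , geodesic
    where
    nearest : ∀ {u k} → Dist G u z k → ∀ w l → w ∈ W → Dist G u w l → k ≤ l
    nearest uz w l w∈W uw rewrite only-z w∈W = ≤-reflexive (dist-unique uz uw)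

  cover : ∀ {S x y} → StrongResolvingSet G S → x ≢ y → MutuallyMaximal G x y →
    x ∈ S ⊎ y ∈ S
  cover {x = x} {y} resolving x≢y mm with resolving x y x≢y
  ... | v , v∈S , resolves with mm-vertex mm resolves
  ...   | inj₁ refl = inj₁ v∈S
  ...   | inj₂ refl = inj₂ v∈S

  separated : ∀ {r x y} {f : Fin n → Fin r} → HasDistances G → StrongResolvingPartition G f →
    x ≢ y → MutuallyMaximal G x y → f x ≢ f y
  separated {x = x} {y} dists (_ , resolving) x≢y mm fx≡fy with resolving x y x≢y fx≡fy
  ... | _ , resolves = mm-set dists mm resolves

  partition-size : ∀ {r k} {f : Fin n → Fin r} → HasDistances G → StrongResolvingPartition G f →
    (c : Fin k → Fin n) → Injective _≡_ _≡_ c →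
    (∀ i j → i ≢ j → MutuallyMaximal G (c i) (c j)) → k ≤ r
  partition-size {f = f} dists partition c c-injective mm = injective⇒≤ f∘c-injective
    where
    f∘c-injective : Injective _≡_ _≡_ (f ∘ c)
    f∘c-injective {i} {j} same-class with i ≟ j
    ... | yes i≡j = i≡j
    ... | no i≢j  =
      ⊥-elim (separated dists partition (i≢j ∘ c-injective) (mm i j i≢j) same-class)

  -- A strong resolving set contains all but at most one member of a family
  -- c₀, …, c_k of pairwise mutually maximal vertices: the j-th chosen vertex is
  -- c_{j+1} if that lies in S and c₀ otherwise.
  clique-cover : ∀ {S k} → StrongResolvingSet G S →
    (c : Fin (suc k) → Fin n) → Injective _≡_ _≡_ c →
    (∀ i j → i ≢ j → MutuallyMaximal G (c i) (c j)) →
    Σ[ g ∈ (Fin k → Fin n) ]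
      Injective _≡_ _≡_ g × (∀ j → g j ∈ S) × (∀ j → ∃[ i ] g j ≡ c i)
  clique-cover {S} {k} resolving c c-injective mm =
    proj₁ ∘ choose , injective , proj₁ ∘ proj₂ ∘ choose , from-c
    where
    Choice : Fin k → Fin n → Set
    Choice j v = v ≡ c (suc j) ⊎ (v ≡ c zero × c (suc j) ∉ S)

    covered : ∀ i j → i ≢ j → c i ∈ S ⊎ c j ∈ S
    covered i j i≢j = cover resolving (i≢j ∘ c-injective) (mm i j i≢j)

    choose : ∀ j → Σ[ v ∈ Fin n ] (v ∈ S × Choice j v)
    choose j with c (suc j) ∈? S
    ... | yes in-S = c (suc j) , in-S , inj₁ refl
    ... | no out   with covered zero (suc j) (λ ())
    ...   | inj₁ c₀∈S  = c zero , c₀∈S , inj₂ (refl , out)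
    ...   | inj₂ in-S  = ⊥-elim (out in-S)

    from-c : ∀ j → ∃[ i ] proj₁ (choose j) ≡ c i
    from-c j with proj₂ (proj₂ (choose j))
    ... | inj₁ e       = suc j , e
    ... | inj₂ (e , _) = zero , e

    same-choice : ∀ {j j′ v} → Choice j v → Choice j′ v → j ≡ j′
    same-choice (inj₁ refl) (inj₁ e)       = fin-suc-injective (c-injective e)
    same-choice (inj₁ refl) (inj₂ (e , _)) with c-injective e
    ... | ()
    same-choice (inj₂ (refl , _)) (inj₁ e) with c-injective e
    ... | ()
    same-choice {j} {j′} (inj₂ (_ , out)) (inj₂ (_ , out′)) with j ≟ j′
    ... | yes j≡j′ = j≡j′
    ... | no j≢j′ with covered (suc j) (suc j′) (j≢j′ ∘ fin-suc-injective)
    ...   | inj₁ in-S = ⊥-elim (out in-S)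
    ...   | inj₂ in-S = ⊥-elim (out′ in-S)

    injective : Injective _≡_ _≡_ (proj₁ ∘ choose)
    injective {j} {j′} same =
      same-choice (proj₂ (proj₂ (choose j)))
                  (subst (Choice j′) (sym same) (proj₂ (proj₂ (choose j′))))

rank : ∀ {n} {x : Fin n} (P : Subset n) → x ∈ P → Fin ∣ P ∣
rank (inside  ∷ P) here        = zero
rank (inside  ∷ P) (there x∈P) = suc (rank P x∈P)
rank (outside ∷ P) (there x∈P) = rank P x∈P

rank-injective : ∀ {n} {x y : Fin n} (P : Subset n) (x∈P : x ∈ P) (y∈P : y ∈ P) →
  rank P x∈P ≡ rank P y∈P → x ≡ y
rank-injective (inside  ∷ P) here        here        _ = refl
rank-injective (inside  ∷ P) (there x∈P) (there y∈P) e =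
  cong suc (rank-injective P x∈P y∈P (fin-suc-injective e))
rank-injective (outside ∷ P) (there x∈P) (there y∈P) e =
  cong suc (rank-injective P x∈P y∈P e)

members-bound : ∀ {n t} (P : Subset n) (g : Fin t → Fin n) →
  Injective _≡_ _≡_ g → (∀ i → g i ∈ P) → t ≤ ∣ P ∣
members-bound P g g-injective g∈P =
  injective⇒≤ (λ {i} {j} e → g-injective (rank-injective P (g∈P i) (g∈P j) e))

combine : ∀ {a b} {X : Set} → (Fin a → X) → (Fin b → X) → Fin (a + b) → X
combine {a} f g i = [ f , g ] (splitAt a i)

combine-injective : ∀ {a b} {X : Set} {f : Fin a → X} {g : Fin b → X} →
  Injective _≡_ _≡_ f → Injective _≡_ _≡_ g → (∀ i j → f i ≢ g j) →
  Injective _≡_ _≡_ (combine f g)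
combine-injective {a} {b} f-inj g-inj disjoint {i} {j} e
  with splitAt a i in split-i | splitAt a j in split-j
... | inj₁ i′ | inj₁ j′ =
  trans (sym (splitAt⁻¹-↑ˡ split-i)) (trans (cong (_↑ˡ b) (f-inj e)) (splitAt⁻¹-↑ˡ split-j))
... | inj₁ i′ | inj₂ j′ = ⊥-elim (disjoint i′ j′ e)
... | inj₂ i′ | inj₁ j′ = ⊥-elim (disjoint j′ i′ (sym e))
... | inj₂ i′ | inj₂ j′ =
  trans (sym (splitAt⁻¹-↑ʳ split-i)) (trans (cong (a ↑ʳ_) (g-inj e)) (splitAt⁻¹-↑ʳ split-j))

combine-∈ : ∀ {n a b} {P : Subset n} {f : Fin a → Fin n} {g : Fin b → Fin n} →
  (∀ i → f i ∈ P) → (∀ j → g j ∈ P) → ∀ k → combine f g k ∈ P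
combine-∈ {a = a} f∈P g∈P k with splitAt a k
... | inj₁ i = f∈P i
... | inj₂ j = g∈P j

∈-Class⁻ : ∀ {n k} {f : Fin n → Fin k} {i x} → x ∈ Class f i → f x ≡ i
∈-Class⁻ {f = f} {i} {zero} x∈C with f zero ≟ i
... | yes fx≡i = fx≡i
∈-Class⁻ {f = f} {i} {zero} () | no _
∈-Class⁻ {f = f} {x = suc x} (there x∈C) = ∈-Class⁻ {f = f ∘ suc} x∈C

∈-Class⁺ : ∀ {n k} {f : Fin n → Fin k} {i x} → f x ≡ i → x ∈ Class f i
∈-Class⁺ {f = f} {i} {zero} fx≡i with f zero ≟ i
... | yes _    = here
... | no fx≢i  = ⊥-elim (fx≢i fx≡i)
∈-Class⁺ {f = f} {x = suc x} fx≡i = there (∈-Class⁺ {f = f ∘ suc} fx≡i)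

∈-++ˡ : ∀ {k l} {x : Fin k} {P : Subset k} (R : Subset l) → x ∈ P → x ↑ˡ l ∈ P ++ R
∈-++ˡ R here        = here
∈-++ˡ R (there x∈P) = there (∈-++ˡ R x∈P)

∈-++ʳ : ∀ {k l} {x : Fin l} {R : Subset l} (P : Subset k) → x ∈ R → k ↑ʳ x ∈ P ++ R
∈-++ʳ []      x∈R = x∈R
∈-++ʳ (_ ∷ P) x∈R = there (∈-++ʳ P x∈R)

∣++∣ : ∀ {k l} (P : Subset k) (R : Subset l) → ∣ P ++ R ∣ ≡ ∣ P ∣ + ∣ R ∣
∣++∣ []            R = refl
∣++∣ (inside  ∷ P) R = cong suc (∣++∣ P R)
∣++∣ (outside ∷ P) R = ∣++∣ P R

-- When
-- every level strictly between 0 and L is occupied, the distance between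
-- distinct vertices is the gap between their levels.
module Layered {n : ℕ} (level : Fin n → ℕ) (L : ℕ) (level≤L : ∀ x → level x ≤ L)
               (occupied : ∀ ℓ → suc ℓ < L → ∃[ x ] level x ≡ suc ℓ) where

  adjacent : Fin n → Fin n → Bool
  adjacent x y with x ≟ y
  ... | yes _ = false
  ... | no _  = gap (level x) (level y) ≤ᵇ 1

  adjacent-sym : ∀ x y → adjacent x y ≡ adjacent y x
  adjacent-sym x y with x ≟ y | y ≟ x
  ... | yes _   | yes _   = refl
  ... | yes x≡y | no y≢x  = ⊥-elim (y≢x (sym x≡y))
  ... | no x≢y  | yes y≡x = ⊥-elim (x≢y (sym y≡x))
  ... | no _    | no _    = cong (_≤ᵇ 1) (gap-comm (level x) (level y))

  adjacent-irrefl : ∀ x → adjacent x x ≡ false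
  adjacent-irrefl x with x ≟ x
  ... | yes _   = refl
  ... | no x≢x  = ⊥-elim (x≢x refl)

  graph : Graph n
  graph = record { adj = adjacent ; sym = adjacent-sym ; irrefl = adjacent-irrefl }

  adjacent-intro : ∀ {x y} → x ≢ y → gap (level x) (level y) ≤ 1 → adjacent x y ≡ true
  adjacent-intro {x} {y} x≢y close with x ≟ y
  ... | yes x≡y = ⊥-elim (x≢y x≡y)
  ... | no _    = T⇒≡true (≤⇒≤ᵇ close)
    where
    T⇒≡true : ∀ {b} → T b → b ≡ true
    T⇒≡true {true} _ = refl

  edge-close : ∀ {x y} → adjacent x y ≡ true → gap (level x) (level y) ≤ 1
  edge-close {x} {y} xy with x ≟ y
  edge-close () | yes _
  ... | no _ = ≤ᵇ⇒≤ _ 1 (subst T (sym xy) _)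

  distance : Fin n → Fin n → ℕ
  distance x y with x ≟ y
  ... | yes _ = 0
  ... | no _  = gap (level x) (level y)

  distance-≢ : ∀ {x y} → x ≢ y → distance x y ≡ gap (level x) (level y)
  distance-≢ {x} {y} x≢y with x ≟ y
  ... | yes x≡y = ⊥-elim (x≢y x≡y)
  ... | no _    = refl

  distance-step : ∀ {x z} y → adjacent x z ≡ true → distance x y ≤ suc (distance z y)
  distance-step {x} {z} y xz with x ≟ y | z ≟ y
  ... | yes _ | _        = z≤n
  ... | no _  | yes refl = edge-close xz
  ... | no _  | no _     =
    ≤-trans (gap-triangle (level x) (level z) (level y)) (+-monoˡ-≤ _ (edge-close xz))

  walk-bound : ∀ {x y k} → Walk graph x y k → distance x y ≤ k
  walk-bound {x} nil            = ≤-reflexive (distance-self x)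
    where
    distance-self : ∀ x → distance x x ≡ 0
    distance-self x with x ≟ x
    ... | yes _  = refl
    ... | no x≢x = ⊥-elim (x≢x refl)
  walk-bound {x} {y} (cons {y = z} xz w) =
    ≤-trans (distance-step {x} {z} y xz) (s≤s (walk-bound w))

  step : ∀ {x z} → level x + 1 ≡ level z → adjacent x z ≡ true
  step {x} {z} up = adjacent-intro x≢z (≤-reflexive gap≡1)
    where
    gap≡1 : gap (level x) (level z) ≡ 1
    gap≡1 = trans (cong (gap (level x)) (sym up)) (gap-above (level x) 0)
    x≢z : x ≢ z
    x≢z refl = m+1+n≢m (level x) up

  climb : ∀ d {x y} → level x + suc d ≡ level y → Walk graph x y (suc d)
  climb zero            up = cons (step up) nil
  climb (suc d) {x} {y} up with occupied (level x) next<L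
    where
    next<L : suc (level x) < L
    next<L = begin
      2 + level x           ≡⟨ +-comm 2 (level x) ⟩
      level x + 2           ≤⟨ +-monoʳ-≤ (level x) (s≤s (s≤s z≤n)) ⟩
      level x + suc (suc d) ≡⟨ up ⟩
      level y               ≤⟨ level≤L y ⟩
      L                     ∎
      where open ≤-Reasoning
  ... | z , level-z =
    cons (step (trans (+-comm (level x) 1) (sym level-z)))
         (climb d (trans (cong (_+ suc d) level-z) (trans (sym (+-suc (level x) (suc d))) up)))

  ascend : ∀ {x y} → level x < level y → Walk graph x y (gap (level x) (level y))
  ascend {x} {y} lx<ly with m≤n⇒∃[o]m+o≡n lx<ly
  ... | d , up = subst (Walk graph x y) (sym gap≡1+d) (climb d up′)
    where
    up′ : level x + suc d ≡ level y
    up′ = trans (+-suc (level x) d) up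
    gap≡1+d : gap (level x) (level y) ≡ suc d
    gap≡1+d = trans (cong (gap (level x)) (sym up′)) (gap-above (level x) d)

  geodesic : ∀ {x y} → x ≢ y → Walk graph x y (gap (level x) (level y))
  geodesic {x} {y} x≢y with <-cmp (level x) (level y)
  ... | tri< lx<ly _ _ = ascend lx<ly
  ... | tri≈ _ lx≡ly _ =
    subst (Walk graph x y) (sym (gap-self lx≡ly)) (cons (adjacent-intro x≢y (≤-reflexive (gap-self lx≡ly))) nil)
  ... | tri> _ _ ly<lx =
    subst (Walk graph x y) (gap-comm (level y) (level x)) (reverse (ascend ly<lx))

  distance-walk : ∀ x y → Walk graph x y (distance x y)
  distance-walk x y with x ≟ y
  ... | yes refl = nil
  ... | no x≢y   = geodesic x≢y

  dist : ∀ x y → Dist graph x y (distance x y)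
  dist x y = distance-walk x y , λ _ → walk-bound

  has-distances : HasDistances graph
  has-distances x y = distance x y , dist x y

  connected : Connected graph
  connected x y = distance x y , distance-walk x y

  dist-≢ : ∀ {x y} → x ≢ y → Dist graph x y (gap (level x) (level y))
  dist-≢ {x} {y} x≢y = subst (Dist graph x y) (distance-≢ x≢y) (dist x y)

  dist-levels : ∀ {x y} → level x ≢ level y → Dist graph x y (gap (level x) (level y))
  dist-levels lx≢ly = dist-≢ (λ x≡y → lx≢ly (cong level x≡y))

  -- Distinct vertices on a common level are true twins, hence mutually maximal.
  same-level-mm : ∀ {x y} → x ≢ y → level x ≡ level y → MutuallyMaximal graph x y
  same-level-mm {x} {y} x≢y lx≡ly = twins-mm xy equidistant
    where
    xy : Dist graph x y 1
    xy = subst (Dist graph x y) (gap-self lx≡ly) (dist-≢ x≢y)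
    equidistant : ∀ v {a c} → v ≢ x → v ≢ y → Dist graph x v a → Dist graph y v c → a ≡ c
    equidistant v {a} {c} v≢x v≢y xv yv = begin
      a                       ≡⟨ dist-unique xv (dist-≢ (v≢x ∘ sym)) ⟩
      gap (level x) (level v) ≡⟨ cong (λ ℓ → gap ℓ (level v)) lx≡ly ⟩
      gap (level y) (level v) ≡⟨ dist-unique (dist-≢ (v≢y ∘ sym)) yv ⟩
      c                       ∎
      where open ≡-Reasoning

  -- A vertex on level 0 and one on level L ≥ 1 realise the diameter L.
  extremes-mm : ∀ {x y} → 1 ≤ L → level x ≡ 0 → level y ≡ L → MutuallyMaximal graph x y
  extremes-mm {x} {y} 1≤L lx≡0 ly≡L = diametral-mm xy diameter
    where
    x≢y : x ≢ y
    x≢y refl = <-irrefl (trans (sym lx≡0) ly≡L) 1≤L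
    xy : Dist graph x y L
    xy = subst (Dist graph x y) (trans (cong₂ gap lx≡0 ly≡L) (m≥n⇒m⊔n≡m 1≤L)) (dist-≢ x≢y)
    diameter : ∀ {u v k} → Dist graph u v k → k ≤ L
    diameter {u} {v} uv rewrite dist-unique uv (dist u v) with u ≟ v
    ... | yes _ = z≤n
    ... | no _  = gap-bounded 1≤L (level≤L u) (level≤L v)

  -- If x < y < v in level order, y lies on a geodesic from x to v; if v < x < y,
  -- x lies on a geodesic from y to v.  Either way v strongly resolves x and y.
  resolved-beyond : ∀ {v x y} → level x < level y → level y < level v →
    StronglyResolvesV graph v x y
  resolved-beyond lx<ly ly<lv =
    _ , _ , _ ,
    dist-levels (<⇒≢ (<-trans lx<ly ly<lv)) , dist-levels (<⇒≢ lx<ly) , dist-levels (<⇒≢ ly<lv) ,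
    inj₁ (gap-additive lx<ly ly<lv)

  resolved-before : ∀ {v x y} → level v < level x → level x < level y →
    StronglyResolvesV graph v x y
  resolved-before {v} {x} {y} lv<lx lx<ly =
    _ , _ , _ ,
    dist-levels (<⇒≢ lv<lx ∘ sym) , dist-levels (<⇒≢ lx<ly) , dist-levels (<⇒≢ (<-trans lv<lx lx<ly) ∘ sym) ,
    inj₂ through-x
    where
    ℓx ℓy ℓv : ℕ
    ℓx = level x
    ℓy = level y
    ℓv = level v
    through-x : gap ℓy ℓv ≡ gap ℓx ℓy + gap ℓx ℓv
    through-x = begin
      gap ℓy ℓv             ≡⟨ gap-comm ℓy ℓv ⟩
      gap ℓv ℓy             ≡⟨ gap-additive lv<lx lx<ly ⟩
      gap ℓv ℓx + gap ℓx ℓy ≡⟨ +-comm (gap ℓv ℓx) (gap ℓx ℓy) ⟩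
      gap ℓx ℓy + gap ℓv ℓx ≡⟨ cong (gap ℓx ℓy +_) (gap-comm ℓv ℓx) ⟩
      gap ℓx ℓy + gap ℓx ℓv ∎
      where open ≡-Reasoning

  resolved-above : ∀ {v x y} → level x ≢ level y → level x < level v → level y < level v →
    StronglyResolvesV graph v x y
  resolved-above {x = x} {y} lx≢ly lx<lv ly<lv with <-cmp (level x) (level y)
  ... | tri< lx<ly _ _ = resolved-beyond lx<ly ly<lv
  ... | tri≈ _ lx≡ly _ = ⊥-elim (lx≢ly lx≡ly)
  ... | tri> _ _ ly<lx = resolves-sym (resolved-beyond ly<lx lx<lv)

  resolved-below : ∀ {v x y} → level x ≢ level y → level v < level x → level v < level y →
    StronglyResolvesV graph v x y
  resolved-below {x = x} {y} lx≢ly lv<lx lv<ly with <-cmp (level x) (level y)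
  ... | tri< lx<ly _ _ = resolved-before lv<lx lx<ly
  ... | tri≈ _ lx≡ly _ = ⊥-elim (lx≢ly lx≡ly)
  ... | tri> _ _ ly<lx = resolves-sym (resolved-before lv<ly ly<lx)

module Construction (m q a : ℕ) where

  s : ℕ
  s = suc (suc a)

  L : ℕ
  L = suc (m + q)

  order : ℕ
  order = suc (m + ((m + q) + s))

  data Vertex : Set where
    root  : Vertex
    twin  : Fin m → Vertex
    spine : Fin (m + q) → Vertex
    top   : Fin s → Vertex

  height : Vertex → ℕ
  height root      = 0
  height (twin i)  = suc (toℕ i)
  height (spine j) = suc (toℕ j)
  height (top k)   = L

  twin-index< : ∀ (i : Fin m) → toℕ i < m + q
  twin-index< i = ≤-trans (toℕ<n i) (m≤m+n m q)

  encode : Vertex → Fin order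
  encode root      = zero
  encode (twin i)  = suc (i ↑ˡ ((m + q) + s))
  encode (spine j) = suc (m ↑ʳ (j ↑ˡ s))
  encode (top k)   = suc (m ↑ʳ ((m + q) ↑ʳ k))

  decode : Fin order → Vertex
  decode zero    = root
  decode (suc x) = [ twin , [ spine , top ] ∘ splitAt (m + q) ] (splitAt m x)

  decode-encode : ∀ v → decode (encode v) ≡ v
  decode-encode root      = refl
  decode-encode (twin i)  rewrite splitAt-↑ˡ m i ((m + q) + s) = refl
  decode-encode (spine j)
    rewrite splitAt-↑ʳ m ((m + q) + s) (j ↑ˡ s) | splitAt-↑ˡ (m + q) j s = refl
  decode-encode (top k)
    rewrite splitAt-↑ʳ m ((m + q) + s) ((m + q) ↑ʳ k) | splitAt-↑ʳ (m + q) s k = refl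

  encode-decode : ∀ x → encode (decode x) ≡ x
  encode-decode zero = refl
  encode-decode (suc x) with splitAt m x in split-x
  ... | inj₁ i = cong suc (splitAt⁻¹-↑ˡ split-x)
  ... | inj₂ y with splitAt (m + q) y in split-y
  ...   | inj₁ j =
    cong suc (trans (cong (m ↑ʳ_) (splitAt⁻¹-↑ˡ split-y)) (splitAt⁻¹-↑ʳ split-x))
  ...   | inj₂ k =
    cong suc (trans (cong (m ↑ʳ_) (splitAt⁻¹-↑ʳ split-y)) (splitAt⁻¹-↑ʳ split-x))

  encode-injective : ∀ {v w} → encode v ≡ encode w → v ≡ w
  encode-injective {v} {w} e =
    trans (sym (decode-encode v)) (trans (cong decode e) (decode-encode w))

  on-vertices : (P : Fin order → Fin order → Set) → (∀ v w → P (encode v) (encode w)) →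
    ∀ x y → P x y
  on-vertices P p x y = subst₂ P (encode-decode x) (encode-decode y) (p (decode x) (decode y))

  level : Fin order → ℕ
  level = height ∘ decode

  level-encode : ∀ v → level (encode v) ≡ height v
  level-encode v = cong height (decode-encode v)

  different-heights : ∀ v w → height v ≢ height w → level (encode v) ≢ level (encode w)
  different-heights v w hv≢hw e = hv≢hw (trans (sym (level-encode v)) (trans e (level-encode w)))

  level≤L : ∀ x → level x ≤ L
  level≤L x with decode x
  ... | root    = z≤n
  ... | twin i  = s≤s (<⇒≤ (twin-index< i))
  ... | spine j = s≤s (<⇒≤ (toℕ<n j))
  ... | top k   = ≤-refl

  occupied : ∀ ℓ → suc ℓ < L → ∃[ x ] level x ≡ suc ℓ
  occupied ℓ ℓ+1<L =
    encode (spine j) , trans (level-encode (spine j)) (cong suc (toℕ-fromℕ< ℓ<m+q))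
    where
    ℓ<m+q : ℓ < m + q
    ℓ<m+q = s≤s⁻¹ ℓ+1<L
    j : Fin (m + q)
    j = fromℕ< ℓ<m+q

  open Layered level L level≤L occupied

  -- The root and the top vertices are pairwise mutually maximal: the root and a
  -- top vertex realise the diameter L, and two top vertices are twins.
  summit : Fin (suc s) → Fin order
  summit zero    = encode root
  summit (suc k) = encode (top k)

  summit-injective : Injective _≡_ _≡_ summit
  summit-injective {zero}  {zero}   _ = refl
  summit-injective {zero}  {suc k}  e with encode-injective {root} {top k} e
  ... | ()
  summit-injective {suc k} {zero}   e with encode-injective {top k} {root} e
  ... | ()
  summit-injective {suc k} {suc k′} e with encode-injective {top k} {top k′} e
  ... | refl = refl

  summit-mm : ∀ i j → i ≢ j → MutuallyMaximal graph (summit i) (summit j)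
  summit-mm zero    zero     i≢j = ⊥-elim (i≢j refl)
  summit-mm zero    (suc k)  _   = root-top-mm k
    where
    root-top-mm : ∀ k → MutuallyMaximal graph (encode root) (encode (top k))
    root-top-mm k = extremes-mm (s≤s z≤n) (level-encode root) (level-encode (top k))
  summit-mm (suc k) zero     i≢j = mm-sym (summit-mm zero (suc k) (i≢j ∘ sym))
  summit-mm (suc k) (suc k′) i≢j =
    same-level-mm (i≢j ∘ summit-injective)
                  (trans (level-encode (top k)) (sym (level-encode (top k′))))

  summit-level : ∀ i → level (summit i) ≡ 0 ⊎ level (summit i) ≡ L
  summit-level zero    = inj₁ (level-encode root)
  summit-level (suc k) = inj₂ (level-encode (top k))

  twin≢spine : ∀ i → encode (twin i) ≢ encode (spine (i ↑ˡ q))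
  twin≢spine i e with encode-injective {twin i} {spine (i ↑ˡ q)} e
  ... | ()

  twin-spine-level : ∀ i → level (encode (spine (i ↑ˡ q))) ≡ suc (toℕ i)
  twin-spine-level i = trans (level-encode (spine (i ↑ˡ q))) (cong suc (toℕ-↑ˡ i q))

  twin-mm : ∀ i → MutuallyMaximal graph (encode (twin i)) (encode (spine (i ↑ˡ q)))
  twin-mm i =
    same-level-mm (twin≢spine i) (trans (level-encode (twin i)) (sym (twin-spine-level i)))

  -- Lower bound: a strong resolving set meets each of the m twin pairs, on
  -- levels 1, …, m, and contains s of the s + 1 summit vertices, on levels 0 and L.
  dim-lower : ∀ {S} → StrongResolvingSet graph S → m + s ≤ ∣ S ∣
  dim-lower {S} resolving with clique-cover resolving summit summit-injective summit-mm
  ... | g , g-injective , g∈S , g-summit =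
    members-bound S (combine pick g)
      (combine-injective pick-injective g-injective disjoint) (combine-∈ pick∈S g∈S)
    where
    choice : ∀ i → Σ[ x ∈ Fin order ] (x ∈ S × level x ≡ suc (toℕ i))
    choice i with cover resolving (twin≢spine i) (twin-mm i)
    ... | inj₁ in-S = encode (twin i) , in-S , level-encode (twin i)
    ... | inj₂ in-S = encode (spine (i ↑ˡ q)) , in-S , twin-spine-level i

    pick : Fin m → Fin order
    pick = proj₁ ∘ choice

    pick∈S : ∀ i → pick i ∈ S
    pick∈S = proj₁ ∘ proj₂ ∘ choice

    pick-level : ∀ i → level (pick i) ≡ suc (toℕ i)
    pick-level = proj₂ ∘ proj₂ ∘ choice

    pick-injective : Injective _≡_ _≡_ pick
    pick-injective {i} {j} e =
      toℕ-injective (suc-injective (trans (sym (pick-level i)) (trans (cong level e) (pick-level j))))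

    -- the picked twin-pair vertices lie on levels 1, …, m, the summit on 0 and L
    disjoint : ∀ i j → pick i ≢ g j
    disjoint i j e with g-summit j
    ... | k , gj≡summit with summit-level k
    ...   | inj₁ at-0 = 0≢1+n (sym (trans (sym (pick-level i)) same-level))
      where
      same-level : level (pick i) ≡ 0
      same-level = trans (cong level (trans e gj≡summit)) at-0
    ...   | inj₂ at-L = <-irrefl (trans (sym (pick-level i)) same-level) (s≤s (twin-index< i))
      where
      same-level : level (pick i) ≡ L
      same-level = trans (cong level (trans e gj≡summit)) at-L

  -- Upper bound: the twins and top vertices form a strong resolving set.  A pair
  -- containing one of them is resolved by it; any other pair consists of
  -- vertices below L on different levels and is resolved by a top vertex.
  basis : Subset order
  basis = outside ∷ (⊤ {m} ++ (⊥ {m + q} ++ ⊤ {s}))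

  ∣basis∣ : ∣ basis ∣ ≡ m + s
  ∣basis∣ = begin
    ∣ ⊤ {m} ++ (⊥ {m + q} ++ ⊤ {s}) ∣   ≡⟨ ∣++∣ (⊤ {m}) _ ⟩
    ∣ ⊤ {m} ∣ + ∣ ⊥ {m + q} ++ ⊤ {s} ∣  ≡⟨ cong₂ _+_ (∣⊤∣≡n m) (∣++∣ (⊥ {m + q}) (⊤ {s})) ⟩
    m + (∣ ⊥ {m + q} ∣ + ∣ ⊤ {s} ∣)
      ≡⟨ cong (m +_) (cong₂ _+_ (∣⊥∣≡0 (m + q)) (∣⊤∣≡n s)) ⟩
    m + s                                ∎
    where open ≡-Reasoning

  twin∈basis : ∀ i → encode (twin i) ∈ basis
  twin∈basis i = there (∈-++ˡ (⊥ {m + q} ++ ⊤ {s}) ∈⊤)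

  top∈basis : ∀ k → encode (top k) ∈ basis
  top∈basis k = there (∈-++ʳ (⊤ {m}) (∈-++ʳ (⊥ {m + q}) ∈⊤))

  below-top : ∀ v w → height v ≢ height w → height v < L → height w < L →
    StronglyResolvesV graph (encode (top zero)) (encode v) (encode w)
  below-top v w hv≢hw hv<L hw<L =
    resolved-above (different-heights v w hv≢hw)
                   (subst₂ _<_ (sym (level-encode v)) (sym (level-encode (top zero))) hv<L)
                   (subst₂ _<_ (sym (level-encode w)) (sym (level-encode (top zero))) hw<L)

  basis-resolving : StrongResolvingSet graph basis
  basis-resolving = on-vertices Resolved resolver
    where
    Resolved : Fin order → Fin order → Set
    Resolved x y = x ≢ y → ∃[ z ] (z ∈ basis × StronglyResolvesV graph z x y)

    resolver : ∀ v w → encode v ≢ encode w →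
      ∃[ z ] (z ∈ basis × StronglyResolvesV graph z (encode v) (encode w))
    resolver v         (twin i)   _   = _ , twin∈basis i , endpoint-resolves (dist _ _)
    resolver v         (top k)    _   = _ , top∈basis k , endpoint-resolves (dist _ _)
    resolver (twin i)  w          _   = _ , twin∈basis i , resolves-sym (endpoint-resolves (dist _ _))
    resolver (top k)   w          _   = _ , top∈basis k , resolves-sym (endpoint-resolves (dist _ _))
    resolver root      root       v≢w = ⊥-elim (v≢w refl)
    resolver root      (spine j)  _   =
      _ , top∈basis zero , below-top root (spine j) (λ ()) (s≤s z≤n) (s≤s (toℕ<n j))
    resolver (spine j) root       _   =
      _ , top∈basis zero , below-top (spine j) root (λ ()) (s≤s (toℕ<n j)) (s≤s z≤n)
    resolver (spine j) (spine j′) v≢w =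
      _ , top∈basis zero , below-top (spine j) (spine j′) hj≢hj′ (s≤s (toℕ<n j)) (s≤s (toℕ<n j′))
      where
      hj≢hj′ : suc (toℕ j) ≢ suc (toℕ j′)
      hj≢hj′ e = v≢w (cong (encode ∘ spine) (toℕ-injective (suc-injective e)))

  dimₛ-is : dimₛ≡ graph (m + s)
  dimₛ-is = (basis , ∣basis∣ , basis-resolving) ,
            λ k (S , ∣S∣≡k , resolving) → subst (m + s ≤_) ∣S∣≡k (dim-lower resolving)

  -- Upper bound for pdₛ: the s + 1 classes {root}, twins ∪ {top 0},
  -- spine ∪ {top 1} and {top k} for k ≥ 2.  Two distinct vertices of a common
  -- class lie on different levels above the root, so {root} strongly resolves them.
  label : Vertex → Fin (suc s)
  label root      = zero
  label (twin _)  = suc zero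
  label (spine _) = suc (suc zero)
  label (top k)   = suc k

  colour : Fin order → Fin (suc s)
  colour = label ∘ decode

  label-zero : ∀ v → label v ≡ zero → v ≡ root
  label-zero root _ = refl

  height-zero : ∀ v → height v ≡ 0 → v ≡ root
  height-zero root _ = refl

  label-height-injective : ∀ v w → label v ≡ label w → height v ≡ height w → v ≡ w
  label-height-injective root      root       _ _ = refl
  label-height-injective root      (twin _)   () _
  label-height-injective root      (spine _)  () _
  label-height-injective root      (top _)    () _
  label-height-injective (twin _)  root       () _
  label-height-injective (twin i)  (twin i′)  _ e = cong twin (toℕ-injective (suc-injective e))
  label-height-injective (twin _)  (spine _)  () _
  label-height-injective (twin i)  (top _)    _ e = ⊥-elim (<-irrefl (suc-injective e) (twin-index< i))
  label-height-injective (spine _) root       () _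
  label-height-injective (spine _) (twin _)   () _
  label-height-injective (spine j) (spine j′) _ e = cong spine (toℕ-injective (suc-injective e))
  label-height-injective (spine j) (top _)    _ e = ⊥-elim (<-irrefl (suc-injective e) (toℕ<n j))
  label-height-injective (top _)   root       () _
  label-height-injective (top _)   (twin i)   _ e = ⊥-elim (<-irrefl (suc-injective (sym e)) (twin-index< i))
  label-height-injective (top _)   (spine j)  _ e = ⊥-elim (<-irrefl (suc-injective (sym e)) (toℕ<n j))
  label-height-injective (top k)   (top k′)   e _ = cong top (fin-suc-injective e)

  root-class : ∀ {x} → x ∈ Class colour zero → x ≡ encode root
  root-class {x} x∈C =
    trans (sym (encode-decode x)) (cong encode (label-zero (decode x) (∈-Class⁻ {f = colour} x∈C)))

  colouring : StrongResolvingPartition graph colour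
  colouring = surjective , on-vertices Resolved resolved
    where
    Resolved : Fin order → Fin order → Set
    Resolved x y = x ≢ y → colour x ≡ colour y → ∃[ i ] StronglyResolvesSet graph (Class colour i) x y

    surjective : Surjective colour
    surjective zero    = encode root , refl
    surjective (suc k) = encode (top k) , cong label (decode-encode (top k))

    off-root : ∀ u → u ≢ root → encode u ∉ Class colour zero
    off-root u u≢root u∈C = u≢root (encode-injective (root-class u∈C))

    above-root : ∀ u → u ≢ root → level (encode root) < level (encode u)
    above-root u u≢root = subst (0 <_) (sym (level-encode u)) (n≢0⇒n>0 (u≢root ∘ height-zero u))

    resolved : ∀ v w → encode v ≢ encode w → colour (encode v) ≡ colour (encode w) →
      ∃[ i ] StronglyResolvesSet graph (Class colour i) (encode v) (encode w)
    resolved v w v≢w same-colour =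
      zero , singleton-resolves (∈-Class⁺ {f = colour} {x = encode root} refl) root-class
                                (off-root v v≢root) (off-root w w≢root)
                                (resolved-below different-levels (above-root v v≢root) (above-root w w≢root))
      where
      same-label : label v ≡ label w
      same-label =
        trans (sym (cong label (decode-encode v))) (trans same-colour (cong label (decode-encode w)))
      v≢root : v ≢ root
      v≢root refl = v≢w (cong encode (sym (label-zero w (sym same-label))))
      w≢root : w ≢ root
      w≢root refl = v≢w (cong encode (label-zero v same-label))
      different-levels : level (encode v) ≢ level (encode w)
      different-levels = different-heights v w (v≢w ∘ cong encode ∘ label-height-injective v w same-label)

  pdₛ-is : pdₛ≡ graph (suc s)
  pdₛ-is = (colour , colouring) ,
           λ r (f , partition) →
             partition-size has-distances partition summit summit-injective summit-mm

  extremal : ∃[ G ] (Connected {order} G × pdₛ≡ G (suc s) × dimₛ≡ G (m + s))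
  extremal = graph , connected , pdₛ-is , dimₛ-is

-- Matching the parameters: r = s + 1 with s = a + 2, t = m + s with m = d + 2,
-- and n = 2m + q + s + 1 where q = (n + r − 2) − 2t ≥ 0.
order-identity : ∀ a d q →
  suc ((2 + d) + ((2 + d + q) + (2 + a))) + suc a ≡ 2 * (4 + a + d) + q
order-identity = solve-∀

dimension-identity : ∀ a d → (2 + d) + (2 + a) ≡ 4 + a + d
dimension-identity = solve-∀

drop-two : ∀ n x → n + suc (suc x) ∸ 2 ≡ n + x
drop-two n x rewrite +-suc n (suc x) | +-suc n x = refl

theorem11 : ∀ (r t n : ℕ) → 3 ≤ r → r < t → 2 * t ≤ n + r ∸ 2 →
    ∃[ G ] (Connected {n} G × pdₛ≡ G r × dimₛ≡ G t)
theorem11 (suc (suc (suc a))) t n (s≤s (s≤s (s≤s z≤n))) r<t 2t≤n+r∸2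
  with m≤n⇒∃[o]m+o≡n r<t
... | d , refl with m≤n⇒∃[o]m+o≡n (≤-trans 2t≤n+r∸2 (≤-reflexive (drop-two n (suc a))))
... | q , 2t+q≡n+1+a =
  subst₂ (λ n′ t′ → ∃[ G ] (Connected {n′} G × pdₛ≡ G (3 + a) × dimₛ≡ G t′))
         order≡n (dimension-identity a d) (Construction.extremal (2 + d) q a)
  where
  order≡n : Construction.order (2 + d) q a ≡ n
  order≡n = +-cancelʳ-≡ (suc a) _ n (trans (order-identity a d q) 2t+q≡n+1+a)
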